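{- Let $k,\sigma\ge1$ and let $p,q$ be distinct Parikh vectors of order $k$ over an alphabet of size $\sigma$. Then the set $\{p,q\}$ is realizable if and only if $p$ and $q$ are neighbors.
   Context: Let $\Sigma=\{a_1<\dots<a_\sigma\}$. For a string $u$, $\mathbf{pv}(u)\in\mathbb{N}^\sigma$ has $i$-th entry the number of occurrences of $a_i$ in $u$; the order of a Parikh vector is the sum of its entries; $e_i=\mathbf{pv}(a_i)$. Two order-$k$ Parikh vectors $p,q$ are neighbors if $q=p-e_i+e_j$ for some $i\neq j$. For a string $s$, $\Pi_k(s)$ denotes the set of Parikh vectors of all length-$k$ substrings of $s$. A set $\Pi$ of order-$k$ Parikh vectors is realizable if there is a string $s$ over $\Sigma$ with $\Pi_k(s)=\Pi$. -}

module Defs where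

open import Data.Nat using (ℕ; zero; suc; _+_; _∸_)
open import Data.Fin using (Fin; _≟_)
open import Data.Vec using (Vec; replicate; zipWith; updateAt; sum)
open import Data.List using (List; length; _++_; foldr)
open import Data.Product using (Σ; ∃; ∃-syntax; _×_)
open import Data.Sum using (_⊎_)
open import Relation.Binary.PropositionalEquality using (_≡_; _≢_)
open import Function.Bundles using (_⇔_)

Str : ℕ → Set
Str σ = List (Fin σ)

PV : ℕ → Set
PV σ = Vec ℕ σ

e : ∀ {σ} → Fin σ → PV σ
e i = updateAt (replicate _ 0) i suc

_⊕_ : ∀ {σ} → PV σ → PV σ → PV σ
_⊕_ = zipWith _+_

_⊖_ : ∀ {σ} → PV σ → PV σ → PV σ
_⊖_ = zipWith _∸_

pv : ∀ {σ} → Str σ → PV σ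
pv = foldr (λ a v → e a ⊕ v) (replicate _ 0)

order : ∀ {σ} → PV σ → ℕ
order = sum

Neighbors : ∀ {σ} → PV σ → PV σ → Set
Neighbors {σ} p q = ∃[ i ] ∃[ j ] (i ≢ j × q ≡ (p ⊖ e i) ⊕ e j)

Substring : ∀ {σ} → Str σ → Str σ → Set
Substring {σ} u s = ∃[ x ] ∃[ y ] (s ≡ x ++ u ++ y)

_∈Π[_]_ : ∀ {σ} → PV σ → ℕ → Str σ → Set
_∈Π[_]_ {σ} r k s = ∃[ u ] (Substring u s × length u ≡ k × pv u ≡ r)

RealizablePair : ∀ {σ} → ℕ → PV σ → PV σ → Set
RealizablePair {σ} k p q =
  ∃[ s ] (∀ (r : PV σ) → (r ∈Π[ k ] s) ⇔ (r ≡ p ⊎ r ≡ q))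

-- Sliding a length-(k+1) window one step drops a letter c and adds a letter d, so
-- consecutive windows have equal or neighboring Parikh vectors.  If a string has
-- only the two window vectors p ≠ q, some step must change the vector, hence p and q
-- are neighbors.  Conversely, if q = p - e_i + e_j, then the string i w j, with w any
-- word of Parikh vector p - e_i, has exactly the two windows i w and w j.
module Submission where

open import Defs
open import Algebra.Definitions using (LeftIdentity; RightIdentity)
open import Data.Nat using (ℕ; zero; suc; _+_; _≤_; _<_; _≥_; s≤s)
open import Data.Nat.Properties
  using (_≟_; +-comm; +-assoc; +-suc; +-identityˡ; suc-injective; 1+n≢n; ≤-trans;
         ≤-reflexive; ≤-pred; <⇒≱; m≤n+m; n<1+n; m<n⇒m<1+n; n≤1+n; +-monoˡ-≤; m≤n⇒m⊓n≡m)
open import Data.Fin using (Fin)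
import Data.Fin as Fin
open import Data.Vec using ([]; _∷_; replicate; sum)
open import Data.Vec.Properties using (≡-dec; zipWith-comm; zipWith-assoc; zipWith-identityˡ; zipWith-identityʳ)
open import Data.List using (List; []; _∷_; length; _++_; take; drop; map)
import Data.List as List
open import Data.List.Properties
  using (length-++; length-++-≤ˡ; length-map; length-replicate; length-take; take-all; take++drop≡id)
open import Data.Product using (∃-syntax; _×_; _,_)
open import Data.Sum using (_⊎_; inj₁; inj₂; [_,_]′)
open import Data.Empty using (⊥-elim)
open import Function using (_∘_)
open import Function.Bundles using (_⇔_; mk⇔; Equivalence)
open import Relation.Binary.Definitions using (DecidableEquality)
open import Relation.Binary.PropositionalEquality
  using (_≡_; _≢_; refl; sym; trans; cong; cong₂; subst; subst₂; module ≡-Reasoning)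
open import Relation.Nullary using (yes; no)

private
  variable
    σ k : ℕ

⊕-comm : (u v : PV σ) → u ⊕ v ≡ v ⊕ u
⊕-comm = zipWith-comm +-comm

⊕-assoc : (u v w : PV σ) → (u ⊕ v) ⊕ w ≡ u ⊕ (v ⊕ w)
⊕-assoc = zipWith-assoc +-assoc

⊕-identityˡ : LeftIdentity _≡_ (replicate σ 0) _⊕_
⊕-identityˡ = zipWith-identityˡ +-identityˡ

⊕-identityʳ : RightIdentity _≡_ (replicate σ 0) _⊕_
⊕-identityʳ = zipWith-identityʳ (λ x → +-comm x 0)

⊖-identityʳ : RightIdentity _≡_ (replicate σ 0) _⊖_
⊖-identityʳ = zipWith-identityʳ (λ _ → refl)

e⊕v⊖e≡v : (c : Fin σ) (v : PV σ) → (e c ⊕ v) ⊖ e c ≡ v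
e⊕v⊖e≡v Fin.zero    (x ∷ v) = cong (x ∷_) (trans (⊖-identityʳ _) (⊕-identityˡ v))
e⊕v⊖e≡v (Fin.suc c) (x ∷ v) = cong (x ∷_) (e⊕v⊖e≡v c v)

order-e⊕ : (c : Fin σ) (v : PV σ) → order (e c ⊕ v) ≡ suc (order v)
order-e⊕ Fin.zero    (x ∷ v) = cong (suc x +_) (cong sum (⊕-identityˡ v))
order-e⊕ (Fin.suc c) (x ∷ v) = trans (cong (x +_) (order-e⊕ c v)) (+-suc x (order v))

-- Truncated subtraction: p ⊖ e i removes a letter exactly when p contains one.
e⊕[p⊖e]≡p⊎p⊖e≡p : (i : Fin σ) (p : PV σ) → e i ⊕ (p ⊖ e i) ≡ p ⊎ p ⊖ e i ≡ p
e⊕[p⊖e]≡p⊎p⊖e≡p Fin.zero    (zero  ∷ p) = inj₂ (cong (0 ∷_) (⊖-identityʳ p))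
e⊕[p⊖e]≡p⊎p⊖e≡p Fin.zero    (suc x ∷ p) = inj₁ (cong (suc x ∷_) (trans (⊕-identityˡ _) (⊖-identityʳ p)))
e⊕[p⊖e]≡p⊎p⊖e≡p (Fin.suc i) (x ∷ p) with e⊕[p⊖e]≡p⊎p⊖e≡p i p
... | inj₁ eq = inj₁ (cong (x ∷_) eq)
... | inj₂ eq = inj₂ (cong (x ∷_) eq)

exchange-neighbors : {x y m : PV σ} {c d : Fin σ} → x ≢ y → x ≡ e c ⊕ m → y ≡ e d ⊕ m → Neighbors x y
exchange-neighbors {m = m} {c} {d} x≢y refl refl = c , d , (λ { refl → x≢y refl }) , (begin
  e d ⊕ m                  ≡⟨ ⊕-comm (e d) m ⟩
  m ⊕ e d                  ≡⟨ cong (_⊕ e d) (e⊕v⊖e≡v c m) ⟨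
  ((e c ⊕ m) ⊖ e c) ⊕ e d  ∎)
  where open ≡-Reasoning

pv-++ : (x y : Str σ) → pv (x ++ y) ≡ pv x ⊕ pv y
pv-++ []      y = sym (⊕-identityˡ (pv y))
pv-++ (a ∷ x) y = trans (cong (e a ⊕_) (pv-++ x y)) (sym (⊕-assoc (e a) (pv x) (pv y)))

pv-snoc : (x : Str σ) (d : Fin σ) → pv (x ++ d ∷ []) ≡ e d ⊕ pv x
pv-snoc x d = trans (pv-++ x (d ∷ [])) (trans (cong (pv x ⊕_) (⊕-identityʳ (e d))) (⊕-comm (pv x) (e d)))

word : PV σ → Str σ
word []      = []
word (m ∷ v) = List.replicate m Fin.zero ++ map Fin.suc (word v)

pv-replicate-zero : ∀ m → pv (List.replicate m (Fin.zero {σ})) ≡ m ∷ replicate σ 0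
pv-replicate-zero zero    = refl
pv-replicate-zero (suc m) = trans (cong (e Fin.zero ⊕_) (pv-replicate-zero m)) (cong (suc m ∷_) (⊕-identityˡ _))

pv-map-suc : (w : Str σ) → pv (map Fin.suc w) ≡ 0 ∷ pv w
pv-map-suc []      = refl
pv-map-suc (a ∷ w) = cong (e (Fin.suc a) ⊕_) (pv-map-suc w)

pv-word : (v : PV σ) → pv (word v) ≡ v
pv-word []      = refl
pv-word (m ∷ v) = begin
  pv (List.replicate m Fin.zero ++ map Fin.suc (word v))   ≡⟨ pv-++ (List.replicate m Fin.zero) _ ⟩
  pv (List.replicate m Fin.zero) ⊕ pv (map Fin.suc (word v)) ≡⟨ cong₂ _⊕_ (pv-replicate-zero m) (pv-map-suc (word v)) ⟩
  (m + 0) ∷ (replicate _ 0 ⊕ pv (word v))                    ≡⟨ cong₂ _∷_ (+-comm m 0) (⊕-identityˡ _) ⟩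
  m ∷ pv (word v)                                            ≡⟨ cong (m ∷_) (pv-word v) ⟩
  m ∷ v                                                      ∎
  where open ≡-Reasoning

length-word : (v : PV σ) → length (word v) ≡ order v
length-word []      = refl
length-word (m ∷ v) = trans (length-++ (List.replicate m Fin.zero))
  (cong₂ _+_ (length-replicate m) (trans (length-map Fin.suc (word v)) (length-word v)))

module _ {A : Set} where

  length-snoc : (w : List A) (x : A) → length (w ++ x ∷ []) ≡ suc (length w)
  length-snoc w x = trans (length-++ w) (+-comm (length w) 1)

  take-length-++ : (u y : List A) → take (length u) (u ++ y) ≡ u
  take-length-++ []      y = refl
  take-length-++ (a ∷ u) y = cong (a ∷_) (take-length-++ u y)

  take-suc-snoc : ∀ n (xs : List A) → n < length xs → ∃[ x ] take (suc n) xs ≡ take n xs ++ x ∷ []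
  take-suc-snoc zero    (x ∷ xs) _       = x , refl
  take-suc-snoc (suc n) (a ∷ xs) (s≤s h) with take-suc-snoc n xs h
  ... | x , eq = x , cong (a ∷_) eq

  window : ℕ → List A → ℕ → List A
  window k s i = take k (drop i s)

  s≡prefix++window++suffix : ∀ k i (s : List A) → s ≡ take i s ++ window k s i ++ drop k (drop i s)
  s≡prefix++window++suffix k i s = sym (trans
    (cong (take i s ++_) (take++drop≡id k (drop i s))) (take++drop≡id i s))

  length-window : ∀ k i (s : List A) → i + k ≤ length s → length (window k s i) ≡ k
  length-window k zero    s       h       = trans (length-take k s) (m≤n⇒m⊓n≡m h)
  length-window k (suc i) (_ ∷ s) (s≤s h) = length-window k i s h

  window-++ : (x u y : List A) → window (length u) (x ++ u ++ y) (length x) ≡ u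
  window-++ []      u y = take-length-++ u y
  window-++ (_ ∷ x) u y = window-++ x u y

  window-++-bound : (x u y : List A) → length x + length u ≤ length (x ++ u ++ y)
  window-++-bound []      u y = length-++-≤ˡ u
  window-++-bound (_ ∷ x) u y = s≤s (window-++-bound x u y)

  window-slide : ∀ k j (s : List A) → suc j + suc k ≤ length s →
    ∃[ c ] ∃[ m ] ∃[ d ] (window (suc k) s j ≡ c ∷ m × window (suc k) s (suc j) ≡ m ++ d ∷ [])
  window-slide k zero    (c ∷ t) (s≤s h) with take-suc-snoc k t h
  ... | d , eq = c , take k t , d , refl , eq
  window-slide k (suc j) (_ ∷ s) (s≤s h) = window-slide k j s h

∈Π⇔window : (r : PV σ) (k : ℕ) (s : Str σ) →
  (r ∈Π[ k ] s) ⇔ (∃[ i ] (i + k ≤ length s × pv (window k s i) ≡ r))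
∈Π⇔window r k s = mk⇔ to from
  where
  to : r ∈Π[ k ] s → ∃[ i ] (i + k ≤ length s × pv (window k s i) ≡ r)
  to (u , (x , y , refl) , refl , refl) = length x , window-++-bound x u y , cong pv (window-++ x u y)
  from : ∃[ i ] (i + k ≤ length s × pv (window k s i) ≡ r) → r ∈Π[ k ] s
  from (i , h , refl) =
    window k s i , (take i s , drop k (drop i s) , s≡prefix++window++suffix k i s) , length-window k i s h , refl

module _ {B : Set} (_≟ᴮ_ : DecidableEquality B) (a : ℕ → B) where

  constant-or-jump : ∀ i → a i ≡ a 0 ⊎ ∃[ j ] (j < i × a j ≢ a (suc j))
  constant-or-jump zero = inj₁ refl
  constant-or-jump (suc i) with constant-or-jump i
  ... | inj₂ (j , j<i , jump) = inj₂ (j , m<n⇒m<1+n j<i , jump)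
  ... | inj₁ aᵢ≡a₀ with a i ≟ᴮ a (suc i)
  ...   | yes eq  = inj₁ (trans (sym eq) aᵢ≡a₀)
  ...   | no jump = inj₂ (i , n<1+n i , jump)

  jump-below : ∀ {i i'} → a i ≢ a i' → ∃[ j ] ((j < i ⊎ j < i') × a j ≢ a (suc j))
  jump-below {i} {i'} aᵢ≢aᵢ' with constant-or-jump i | constant-or-jump i'
  ... | inj₂ (j , j<i , jump) | _                      = j , inj₁ j<i , jump
  ... | inj₁ _                | inj₂ (j , j<i' , jump) = j , inj₂ j<i' , jump
  ... | inj₁ aᵢ≡a₀            | inj₁ aᵢ'≡a₀            = ⊥-elim (aᵢ≢aᵢ' (trans aᵢ≡a₀ (sym aᵢ'≡a₀)))

prefix-suffix-realizable : (c d : Fin σ) (w : Str σ) →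
  RealizablePair (suc (length w)) (pv (c ∷ w)) (pv (w ++ d ∷ []))
prefix-suffix-realizable c d w = s , λ r →
  mk⇔ (windows r ∘ Equivalence.to (∈Π⇔window r n s)) (Equivalence.from (∈Π⇔window r n s) ∘ window-of r)
  where
  n = suc (length w)
  s = c ∷ w ++ d ∷ []

  length-s : length s ≡ suc n
  length-s = cong suc (length-snoc w d)

  prefix : window n s 0 ≡ c ∷ w
  prefix = cong (c ∷_) (take-length-++ w (d ∷ []))

  suffix : window n s 1 ≡ w ++ d ∷ []
  suffix = take-all n (w ++ d ∷ []) (≤-reflexive (length-snoc w d))

  windows : ∀ r → ∃[ i ] (i + n ≤ length s × pv (window n s i) ≡ r) → r ≡ pv (c ∷ w) ⊎ r ≡ pv (w ++ d ∷ [])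
  windows _ (0 , _ , refl) = inj₁ (cong pv prefix)
  windows _ (1 , _ , refl) = inj₂ (cong pv suffix)
  windows _ (suc (suc i) , h , _) =
    ⊥-elim (<⇒≱ (m≤n+m n i) (≤-pred (≤-pred (≤-trans h (≤-reflexive length-s)))))

  window-of : ∀ r → r ≡ pv (c ∷ w) ⊎ r ≡ pv (w ++ d ∷ []) → ∃[ i ] (i + n ≤ length s × pv (window n s i) ≡ r)
  window-of _ (inj₁ refl) = 0 , s≤s (length-++-≤ˡ w) , cong pv prefix
  window-of _ (inj₂ refl) = 1 , ≤-reflexive (sym length-s) , cong pv suffix

exchange-realizable : (c d : Fin σ) {m : PV σ} → order m ≡ k → RealizablePair (suc k) (e c ⊕ m) (e d ⊕ m)
exchange-realizable c d {m} refl =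
  subst (λ n → RealizablePair (suc n) (e c ⊕ m) (e d ⊕ m)) (length-word m)
    (subst₂ (RealizablePair _) (cong (e c ⊕_) (pv-word m)) (trans (pv-snoc (word m) d) (cong (e d ⊕_) (pv-word m)))
      (prefix-suffix-realizable c d (word m)))

neighbors⇒realizable : {p q : PV σ} → order p ≡ suc k → order q ≡ suc k → Neighbors p q → RealizablePair (suc k) p q
neighbors⇒realizable {k = k} {p} ∣p∣ ∣q∣ (i , j , _ , refl) with e⊕[p⊖e]≡p⊎p⊖e≡p i p
... | inj₁ eᵢ⊕m≡p = subst₂ (RealizablePair (suc k)) eᵢ⊕m≡p (⊕-comm (e j) _)
  (exchange-realizable i j (suc-injective (trans (sym (order-e⊕ i _)) (trans (cong order eᵢ⊕m≡p) ∣p∣))))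
-- Without a letter i in p, the exchange would only add e j and raise the order.
... | inj₂ p⊖eᵢ≡p = ⊥-elim (1+n≢n (begin
  suc (suc k)                ≡⟨ cong suc ∣p∣ ⟨
  suc (order p)              ≡⟨ order-e⊕ j p ⟨
  order (e j ⊕ p)            ≡⟨ cong order (⊕-comm (e j) p) ⟩
  order (p ⊕ e j)            ≡⟨ cong (λ v → order (v ⊕ e j)) p⊖eᵢ≡p ⟨
  order ((p ⊖ e i) ⊕ e j)    ≡⟨ ∣q∣ ⟩
  suc k                      ∎))
  where open ≡-Reasoning

realizable⇒neighbors : {p q : PV σ} → p ≢ q → RealizablePair (suc k) p q → Neighbors p q
realizable⇒neighbors {k = k} {p} {q} p≢q (s , Πₛ≡pq) =
  let i  , hᵢ  , wᵢ≡p  = window-of (inj₁ refl)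
      i' , hᵢ' , wᵢ'≡q = window-of (inj₂ refl)
      j , j<i⊎j<i' , jump = jump-below (≡-dec _≟_) w {i} {i'} (λ eq → p≢q (trans (sym wᵢ≡p) (trans eq wᵢ'≡q)))
      hⱼ₊₁ = [ below hᵢ , below hᵢ' ]′ j<i⊎j<i'
      c , m , d , slideⱼ , slideⱼ₊₁ = window-slide k j s hⱼ₊₁
      wⱼ≡ = cong pv slideⱼ
      wⱼ₊₁≡ = trans (cong pv slideⱼ₊₁) (pv-snoc m d)
  in  pair-neighbors jump (exchange-neighbors jump wⱼ≡ wⱼ₊₁≡) (exchange-neighbors (jump ∘ sym) wⱼ₊₁≡ wⱼ≡)
        (member j (≤-trans (n≤1+n _) hⱼ₊₁)) (member (suc j) hⱼ₊₁)
  where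
  w : ℕ → PV _
  w = pv ∘ window (suc k) s

  window-of : ∀ {r} → r ≡ p ⊎ r ≡ q → ∃[ i ] (i + suc k ≤ length s × w i ≡ r)
  window-of {r} = Equivalence.to (∈Π⇔window r (suc k) s) ∘ Equivalence.from (Πₛ≡pq r)

  member : ∀ i → i + suc k ≤ length s → w i ≡ p ⊎ w i ≡ q
  member i h = Equivalence.to (Πₛ≡pq _) (Equivalence.from (∈Π⇔window _ (suc k) s) (i , h , refl))

  below : ∀ {i j} → i + suc k ≤ length s → j < i → suc j + suc k ≤ length s
  below h j<i = ≤-trans (+-monoˡ-≤ (suc k) j<i) h

  pair-neighbors : ∀ {x y} → x ≢ y → Neighbors x y → Neighbors y x → x ≡ p ⊎ x ≡ q → y ≡ p ⊎ y ≡ q → Neighbors p q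
  pair-neighbors _   xy _  (inj₁ refl) (inj₂ refl) = xy
  pair-neighbors _   _  yx (inj₂ refl) (inj₁ refl) = yx
  pair-neighbors x≢y _  _  (inj₁ refl) (inj₁ refl) = ⊥-elim (x≢y refl)
  pair-neighbors x≢y _  _  (inj₂ refl) (inj₂ refl) = ⊥-elim (x≢y refl)

lemma3 : (k σ : ℕ) → k ≥ 1 → σ ≥ 1 → (p q : PV σ) →
    order p ≡ k → order q ≡ k → p ≢ q →
    RealizablePair k p q ⇔ Neighbors p q
lemma3 (suc k) σ _ _ p q ∣p∣ ∣q∣ p≢q = mk⇔ (realizable⇒neighbors p≢q) (neighbors⇒realizable ∣p∣ ∣q∣)
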